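{- For every integer $n\ge0$, \[ \left(M_{H,n+1}^{(3)}\right)^{2}=\left(M_{H,1}^{(3)}\right)^{2}M_{h,2n}^{(3)}=M_{H,1}^{(3)}M_{H,2n+1}^{(3)} \quad\text{and}\quad \left(M_{H,n+1}^{(3)}\right)^{3}=\left(M_{H,1}^{(3)}\right)^{3}M_{h,3n}^{(3)}=\left(M_{H,1}^{(3)}\right)^{2}M_{H,3n+1}^{(3)}. \]
   Context: Let $r,s,t,a,b,c$ be real numbers with $t\neq0$ (the paper also assumes throughout that $\Delta=\frac{r^{3}t}{27}-\frac{r^{2}s^{2}}{108}+\frac{rst}{6}-\frac{s^{3}}{27}+\frac{t^{2}}{4}>0$). The third-order Horadam matrix sequence $(M_{H,n}^{(3)})_{n\ge0}$ of $3\times3$ matrices is defined by $M_{H,n+3}^{(3)}=rM_{H,n+2}^{(3)}+sM_{H,n+1}^{(3)}+tM_{H,n}^{(3)}$ ($n\ge0$) with $M_{H,0}^{(3)}=\begin{bmatrix} b& c-rb& ta\\ a& b-ra& c-rb-sa\\ \frac1t(c-rb-sa)& \frac1t\left(ta-r(c-rb-sa)\right)& \frac1t\left(-sc+(t+rs)b+(s^2-rt)a\right)\end{bmatrix}$, $M_{H,1}^{(3)}=\begin{bmatrix} c& sb+ta& tb\\ b& c-rb& ta\\ a& b-ra& c-rb-sa\end{bmatrix}$, $M_{H,2}^{(3)}=\begin{bmatrix} rc+sb+ta& sc+tb& tc\\ c& sb+ta& tb\\ b& c-rb& ta\end{bmatrix}$. The generalized Tribonacci matrix sequence $(M_{h,n}^{(3)})_{n\ge0}$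 satisfies $M_{h,n+3}^{(3)}=rM_{h,n+2}^{(3)}+sM_{h,n+1}^{(3)}+tM_{h,n}^{(3)}$ with $M_{h,0}^{(3)}=I_3$, $M_{h,1}^{(3)}=\begin{bmatrix} r&s&t\\1&0&0\\0&1&0\end{bmatrix}$, $M_{h,2}^{(3)}=\begin{bmatrix} r^2+s& rs+t& rt\\ r&s&t\\ 1&0&0\end{bmatrix}$. -}

module Defs where

open import Level using (Level)
open import Data.Nat using (ℕ; zero; suc)
open import Data.Fin using (Fin; zero; suc)
open import Algebra.Bundles using (CommutativeRing)

module Matrices {c ℓ : Level} (R : CommutativeRing c ℓ) where
  open CommutativeRing R using (Carrier; _≈_; _+_; _-_; -_; 0#; 1#) renaming (_*_ to _·_)

  infix 4 _≈ₘ_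
  infixl 7 _⊗_

  Mat3 : Set c
  Mat3 = Fin 3 → Fin 3 → Carrier

  _≈ₘ_ : Mat3 → Mat3 → Set ℓ
  A ≈ₘ B = ∀ i j → A i j ≈ B i j

  _⊗_ : Mat3 → Mat3 → Mat3
  (A ⊗ B) i j = A i zero · B zero j + (A i (suc zero) · B (suc zero) j + A i (suc (suc zero)) · B (suc (suc zero)) j)

  lin3 : Carrier → Mat3 → Carrier → Mat3 → Carrier → Mat3 → Mat3
  lin3 x A y B z C i j = x · A i j + (y · B i j + z · C i j)

  mat : Carrier → Carrier → Carrier → Carrier → Carrier → Carrier →
        Carrier → Carrier → Carrier → Mat3
  mat a00 a01 a02 a10 a11 a12 a20 a21 a22 = f
    where
      f : Mat3
      f zero zero = a00
      f zero (suc zero) = a01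
      f zero (suc (suc zero)) = a02
      f (suc zero) zero = a10
      f (suc zero) (suc zero) = a11
      f (suc zero) (suc (suc zero)) = a12
      f (suc (suc zero)) zero = a20
      f (suc (suc zero)) (suc zero) = a21
      f (suc (suc zero)) (suc (suc zero)) = a22

  rec3 : (r s t : Carrier) → Mat3 → Mat3 → Mat3 → ℕ → Mat3
  rec3 r s t X0 X1 X2 zero = X0
  rec3 r s t X0 X1 X2 (suc zero) = X1
  rec3 r s t X0 X1 X2 (suc (suc zero)) = X2
  rec3 r s t X0 X1 X2 (suc (suc (suc n))) =
    lin3 r (rec3 r s t X0 X1 X2 (suc (suc n))) s (rec3 r s t X0 X1 X2 (suc n)) t (rec3 r s t X0 X1 X2 n)

  Mh : (r s t : Carrier) → ℕ → Mat3
  Mh r s t = rec3 r s t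
    (mat 1# 0# 0#  0# 1# 0#  0# 0# 1#)
    (mat r s t  1# 0# 0#  0# 1# 0#)
    (mat (r · r + s) (r · s + t) (r · t)  r s t  1# 0# 0#)

  -- third-order Horadam matrix sequence M_{H,n}^{(3)};
  -- tinv plays the role of 1/t (a two-sided inverse of t is supplied separately)
  MH1 : (r s t a b c : Carrier) → Mat3
  MH1 r s t a b c =
    mat c (s · b + t · a) (t · b)
        b (c - r · b) (t · a)
        a (b - r · a) (c - r · b - s · a)

  MH : (r s t tinv a b c : Carrier) → ℕ → Mat3
  MH r s t tinv a b c = rec3 r s t
    (mat b (c - r · b) (t · a)
         a (b - r · a) (c - r · b - s · a)
         (tinv · (c - r · b - s · a))
         (tinv · (t · a - r · (c - r · b - s · a)))
         (tinv · (- (s · c) + (t + r · s) · b + (s · s - r · t) · a)))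
    (MH1 r s t a b c)
    (mat (r · c + s · b + t · a) (s · c + t · b) (t · c)
         c (s · b + t · a) (t · b)
         b (c - r · b) (t · a))

module Submission where

-- Let T = M_{h,1} be the companion matrix of x³ - r x² - s x - t. Both matrix sequences satisfy
-- X (n + 1) = T X n: this is checked directly for n = 0, 1 and then propagates through the
-- recurrence because T³ = r T² + s T + t I (Cayley–Hamilton). Hence M_{h,n} = Tⁿ and
-- M_{H,n+1} = Tⁿ M_{H,1}. Moreover M_{H,1} = (c - r b - s a) I + (b - r a) T + a T² is a
-- polynomial in T, so it commutes with every Tⁿ; therefore (M_{H,n+1})ᵏ = (M_{H,1})ᵏ T^{kn},
-- and M_{H,1} T^m = M_{H,m+1} gives the second form of each identity.

open import Defs
open import Level using (Level)
open import Data.Nat as ℕ using (ℕ; zero; suc)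
open import Data.Product using (_×_; _,_)
open import Algebra.Bundles using (CommutativeRing)

import Data.Nat.Properties as ℕ
open import Data.Fin.Patterns using (0F; 1F; 2F)
open import Data.Integer as ℤ using (ℤ; +_; -[1+_]; 0ℤ; 1ℤ; sign; ∣_∣; _◃_; _⊖_)
import Data.Integer.Properties as ℤ
open import Data.Sign as Sign using (Sign)
open import Data.Maybe using (Maybe; map)
open import Relation.Binary.Consequences using (dec⇒weaklyDec)
import Relation.Binary.PropositionalEquality as ≡
open import Relation.Binary.Bundles using (Setoid)
import Relation.Binary.Reasoning.Setoid as SetoidReasoning
open import Algebra.Solver.Ring.AlmostCommutativeRing using (fromCommutativeRing; _-Raw-AlmostCommutative⟶_)

-- The ring solver needs coefficients with decidable equality; ℤ maps into every commutative ring.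
module IntegerCoefficients {ℓ₁ ℓ₂ : Level} (R : CommutativeRing ℓ₁ ℓ₂) where
  open CommutativeRing R
  open import Algebra.Properties.Ring ring using (-‿distribˡ-*; -‿distribʳ-*; -0#≈0#; -‿involutive; -‿+-comm)
  open import Algebra.Properties.Semiring.Mult.TCOptimised semiring using (×-homo-+; ×1-homo-*) renaming (_×_ to _×′_)
  open import Algebra.Properties.CommutativeSemigroup +-commutativeSemigroup using (x∙yz≈y∙xz)
  open SetoidReasoning setoid

  fromℕ : ℕ → Carrier
  fromℕ n = n ×′ 1#

  fromℤ : ℤ → Carrier
  fromℤ (+ n) = fromℕ n
  fromℤ -[1+ n ] = - fromℕ (suc n)

  fromℕ-suc : ∀ n → fromℕ (suc n) ≈ 1# + fromℕ n
  fromℕ-suc = ×-homo-+ 1# 1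

  signed : Sign → Carrier → Carrier
  signed Sign.+ x = x
  signed Sign.- x = - x

  signed-cong : ∀ σ {x y} → x ≈ y → signed σ x ≈ signed σ y
  signed-cong Sign.+ x≈y = x≈y
  signed-cong Sign.- x≈y = -‿cong x≈y

  signed-* : ∀ σ τ x y → signed (σ Sign.* τ) (x * y) ≈ signed σ x * signed τ y
  signed-* Sign.+ Sign.+ x y = refl
  signed-* Sign.+ Sign.- x y = -‿distribʳ-* x y
  signed-* Sign.- Sign.+ x y = -‿distribˡ-* x y
  signed-* Sign.- Sign.- x y = begin
    x * y         ≈⟨ -‿involutive (x * y) ⟨
    - - (x * y)   ≈⟨ -‿cong (-‿distribˡ-* x y) ⟩
    - (- x * y)   ≈⟨ -‿distribʳ-* (- x) y ⟩
    - x * - y     ∎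

  fromℤ-◃ : ∀ σ n → fromℤ (σ ◃ n) ≈ signed σ (fromℕ n)
  fromℤ-◃ Sign.+ zero = refl
  fromℤ-◃ Sign.- zero = sym -0#≈0#
  fromℤ-◃ Sign.+ (suc n) = refl
  fromℤ-◃ Sign.- (suc n) = refl

  fromℤ-signed : ∀ i → fromℤ i ≈ signed (sign i) (fromℕ ∣ i ∣)
  fromℤ-signed (+ n) = refl
  fromℤ-signed -[1+ n ] = refl

  fromℤ-⊖ : ∀ m n → fromℤ (m ⊖ n) ≈ fromℕ m - fromℕ n
  fromℤ-⊖ m zero = sym (trans (+-congˡ -0#≈0#) (+-identityʳ _))
  fromℤ-⊖ zero (suc n) = sym (+-identityˡ _)
  fromℤ-⊖ (suc m) (suc n) = begin
    fromℤ (suc m ⊖ suc n)               ≡⟨ ≡.cong fromℤ (ℤ.[1+m]⊖[1+n]≡m⊖n m n) ⟩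
    fromℤ (m ⊖ n)                       ≈⟨ fromℤ-⊖ m n ⟩
    fromℕ m - fromℕ n                   ≈⟨ cancel 1# (fromℕ m) (fromℕ n) ⟨
    (1# + fromℕ m) - (1# + fromℕ n)     ≈⟨ +-cong (fromℕ-suc m) (-‿cong (fromℕ-suc n)) ⟨
    fromℕ (suc m) - fromℕ (suc n)       ∎
    where
    cancel : ∀ x y z → (x + y) - (x + z) ≈ y - z
    cancel x y z = begin
      (x + y) - (x + z)       ≈⟨ +-congˡ (-‿+-comm x z) ⟨
      (x + y) + (- x + - z)   ≈⟨ +-assoc x y (- x + - z) ⟩
      x + (y + (- x + - z))   ≈⟨ +-congˡ (x∙yz≈y∙xz y (- x) (- z)) ⟩
      x + (- x + (y - z))     ≈⟨ +-assoc x (- x) (y - z) ⟨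
      (x - x) + (y - z)       ≈⟨ +-congʳ (-‿inverseʳ x) ⟩
      0# + (y - z)            ≈⟨ +-identityˡ (y - z) ⟩
      y - z                   ∎

  fromℤ-+ : ∀ i j → fromℤ (i ℤ.+ j) ≈ fromℤ i + fromℤ j
  fromℤ-+ (+ m) (+ n) = ×-homo-+ 1# m n
  fromℤ-+ (+ m) -[1+ n ] = fromℤ-⊖ m (suc n)
  fromℤ-+ -[1+ m ] (+ n) = trans (fromℤ-⊖ n (suc m)) (+-comm _ _)
  fromℤ-+ -[1+ m ] -[1+ n ] = begin
    - fromℕ (suc (suc (m ℕ.+ n)))        ≡⟨ ≡.cong (λ k → - fromℕ (suc k)) (ℕ.+-suc m n) ⟨
    - fromℕ (suc m ℕ.+ suc n)            ≈⟨ -‿cong (×-homo-+ 1# (suc m) (suc n)) ⟩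
    - (fromℕ (suc m) + fromℕ (suc n))    ≈⟨ -‿+-comm _ _ ⟨
    - fromℕ (suc m) + - fromℕ (suc n)    ∎

  fromℤ-* : ∀ i j → fromℤ (i ℤ.* j) ≈ fromℤ i * fromℤ j
  fromℤ-* i j = begin
    fromℤ (sign i Sign.* sign j ◃ ∣ i ∣ ℕ.* ∣ j ∣)               ≈⟨ fromℤ-◃ (sign i Sign.* sign j) (∣ i ∣ ℕ.* ∣ j ∣) ⟩
    signed (sign i Sign.* sign j) (fromℕ (∣ i ∣ ℕ.* ∣ j ∣))      ≈⟨ signed-cong (sign i Sign.* sign j) (×1-homo-* ∣ i ∣ ∣ j ∣) ⟩
    signed (sign i Sign.* sign j) (fromℕ ∣ i ∣ * fromℕ ∣ j ∣)    ≈⟨ signed-* (sign i) (sign j) _ _ ⟩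
    signed (sign i) (fromℕ ∣ i ∣) * signed (sign j) (fromℕ ∣ j ∣) ≈⟨ *-cong (fromℤ-signed i) (fromℤ-signed j) ⟨
    fromℤ i * fromℤ j                                            ∎

  fromℤ-neg : ∀ i → fromℤ (ℤ.- i) ≈ - fromℤ i
  fromℤ-neg (+ zero) = sym -0#≈0#
  fromℤ-neg (+ suc n) = refl
  fromℤ-neg -[1+ n ] = sym (-‿involutive _)

  homomorphism : ℤ.+-*-rawRing -Raw-AlmostCommutative⟶ fromCommutativeRing R
  homomorphism = record
    { ⟦_⟧ = fromℤ
    ; +-homo = fromℤ-+
    ; *-homo = fromℤ-*
    ; -‿homo = fromℤ-neg
    ; 0-homo = refl
    ; 1-homo = refl
    }

  fromℤ-≟ : ∀ i j → Maybe (fromℤ i ≈ fromℤ j)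
  fromℤ-≟ i j = map (λ { ≡.refl → refl }) (dec⇒weaklyDec ℤ._≟_ i j)

  open import Algebra.Solver.Ring ℤ.+-*-rawRing (fromCommutativeRing R) homomorphism fromℤ-≟ public

module MatrixAlgebra {ℓ₁ ℓ₂ : Level} (R : CommutativeRing ℓ₁ ℓ₂) where
  open CommutativeRing R using (_≈_; _+_; 0#; 1#; refl; sym; trans; +-cong; *-cong; *-congˡ)
    renaming (_*_ to _·_)
  open IntegerCoefficients R using (Polynomial; solve; _:=_; _:+_; _:*_; con)
  open Matrices R

  Mat3-setoid : Setoid ℓ₁ ℓ₂
  Mat3-setoid = record
    { Carrier = Mat3
    ; _≈_ = _≈ₘ_
    ; isEquivalence = record
      { refl = λ _ _ → refl
      ; sym = λ A≈B i j → sym (A≈B i j)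
      ; trans = λ A≈B B≈C i j → trans (A≈B i j) (B≈C i j)
      }
    }

  open Setoid Mat3-setoid public using () renaming (refl to ≈ₘ-refl; sym to ≈ₘ-sym; trans to ≈ₘ-trans)

  entrywise : ∀ {A B} →
    A 0F 0F ≈ B 0F 0F → A 0F 1F ≈ B 0F 1F → A 0F 2F ≈ B 0F 2F →
    A 1F 0F ≈ B 1F 0F → A 1F 1F ≈ B 1F 1F → A 1F 2F ≈ B 1F 2F →
    A 2F 0F ≈ B 2F 0F → A 2F 1F ≈ B 2F 1F → A 2F 2F ≈ B 2F 2F → A ≈ₘ B
  entrywise e₀₀ e₀₁ e₀₂ e₁₀ e₁₁ e₁₂ e₂₀ e₂₁ e₂₂ = λ where
    0F 0F → e₀₀ ; 0F 1F → e₀₁ ; 0F 2F → e₀₂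
    1F 0F → e₁₀ ; 1F 1F → e₁₁ ; 1F 2F → e₁₂
    2F 0F → e₂₀ ; 2F 1F → e₂₁ ; 2F 2F → e₂₂

  ⊗-cong : ∀ {A A′ B B′} → A ≈ₘ A′ → B ≈ₘ B′ → A ⊗ B ≈ₘ A′ ⊗ B′
  ⊗-cong A≈ B≈ i j = +-cong (*-cong (A≈ i 0F) (B≈ 0F j))
    (+-cong (*-cong (A≈ i 1F) (B≈ 1F j)) (*-cong (A≈ i 2F) (B≈ 2F j)))

  ⊗-congˡ : ∀ A {B B′} → B ≈ₘ B′ → A ⊗ B ≈ₘ A ⊗ B′
  ⊗-congˡ A = ⊗-cong (≈ₘ-refl {A})

  ⊗-congʳ : ∀ B {A A′} → A ≈ₘ A′ → A ⊗ B ≈ₘ A′ ⊗ B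
  ⊗-congʳ B A≈ = ⊗-cong A≈ (≈ₘ-refl {B})

  lin3-cong : ∀ x y z {A A′ B B′ C C′} → A ≈ₘ A′ → B ≈ₘ B′ → C ≈ₘ C′ →
              lin3 x A y B z C ≈ₘ lin3 x A′ y B′ z C′
  lin3-cong x y z A≈ B≈ C≈ i j = +-cong (*-congˡ (A≈ i j)) (+-cong (*-congˡ (B≈ i j)) (*-congˡ (C≈ i j)))

  dot : ∀ {n} → (x₀ x₁ x₂ y₀ y₁ y₂ : Polynomial n) → Polynomial n
  dot x₀ x₁ x₂ y₀ y₁ y₂ = x₀ :* y₀ :+ (x₁ :* y₁ :+ x₂ :* y₂)

  ⊗-assoc : ∀ A B C → (A ⊗ B) ⊗ C ≈ₘ A ⊗ (B ⊗ C)
  ⊗-assoc A B C i j = solve 15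
    (λ a₀ a₁ a₂ b₀₀ b₀₁ b₀₂ b₁₀ b₁₁ b₁₂ b₂₀ b₂₁ b₂₂ c₀ c₁ c₂ →
       dot (dot a₀ a₁ a₂ b₀₀ b₁₀ b₂₀) (dot a₀ a₁ a₂ b₀₁ b₁₁ b₂₁) (dot a₀ a₁ a₂ b₀₂ b₁₂ b₂₂) c₀ c₁ c₂
       := dot a₀ a₁ a₂ (dot b₀₀ b₀₁ b₀₂ c₀ c₁ c₂) (dot b₁₀ b₁₁ b₁₂ c₀ c₁ c₂) (dot b₂₀ b₂₁ b₂₂ c₀ c₁ c₂))
    refl (A i 0F) (A i 1F) (A i 2F)
    (B 0F 0F) (B 0F 1F) (B 0F 2F)
    (B 1F 0F) (B 1F 1F) (B 1F 2F)
    (B 2F 0F) (B 2F 1F) (B 2F 2F)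
    (C 0F j) (C 1F j) (C 2F j)

  ⊗-distribˡ-lin3 : ∀ A x B y C z D → A ⊗ lin3 x B y C z D ≈ₘ lin3 x (A ⊗ B) y (A ⊗ C) z (A ⊗ D)
  ⊗-distribˡ-lin3 A x B y C z D i j = solve 15
    (λ x y z a₀ a₁ a₂ b₀ b₁ b₂ c₀ c₁ c₂ d₀ d₁ d₂ →
       dot a₀ a₁ a₂ (x :* b₀ :+ (y :* c₀ :+ z :* d₀)) (x :* b₁ :+ (y :* c₁ :+ z :* d₁)) (x :* b₂ :+ (y :* c₂ :+ z :* d₂))
       := x :* dot a₀ a₁ a₂ b₀ b₁ b₂ :+ (y :* dot a₀ a₁ a₂ c₀ c₁ c₂ :+ z :* dot a₀ a₁ a₂ d₀ d₁ d₂))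
    refl x y z (A i 0F) (A i 1F) (A i 2F)
    (B 0F j) (B 1F j) (B 2F j)
    (C 0F j) (C 1F j) (C 2F j)
    (D 0F j) (D 1F j) (D 2F j)

  ⊗-distribʳ-lin3 : ∀ x A y B z C D → lin3 x A y B z C ⊗ D ≈ₘ lin3 x (A ⊗ D) y (B ⊗ D) z (C ⊗ D)
  ⊗-distribʳ-lin3 x A y B z C D i j = solve 15
    (λ x y z a₀ a₁ a₂ b₀ b₁ b₂ c₀ c₁ c₂ d₀ d₁ d₂ →
       dot (x :* a₀ :+ (y :* b₀ :+ z :* c₀)) (x :* a₁ :+ (y :* b₁ :+ z :* c₁)) (x :* a₂ :+ (y :* b₂ :+ z :* c₂)) d₀ d₁ d₂
       := x :* dot a₀ a₁ a₂ d₀ d₁ d₂ :+ (y :* dot b₀ b₁ b₂ d₀ d₁ d₂ :+ z :* dot c₀ c₁ c₂ d₀ d₁ d₂))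
    refl x y z (A i 0F) (A i 1F) (A i 2F)
    (B i 0F) (B i 1F) (B i 2F)
    (C i 0F) (C i 1F) (C i 2F)
    (D 0F j) (D 1F j) (D 2F j)

  1x+0y+0z≈x : ∀ x y z → 1# · x + (0# · y + 0# · z) ≈ x
  1x+0y+0z≈x = solve 3 (λ x y z → dot (con 1ℤ) (con 0ℤ) (con 0ℤ) x y z := x) refl

  0x+1y+0z≈y : ∀ x y z → 0# · x + (1# · y + 0# · z) ≈ y
  0x+1y+0z≈y = solve 3 (λ x y z → dot (con 0ℤ) (con 1ℤ) (con 0ℤ) x y z := y) refl

  0x+0y+1z≈z : ∀ x y z → 0# · x + (0# · y + 1# · z) ≈ z
  0x+0y+1z≈z = solve 3 (λ x y z → dot (con 0ℤ) (con 0ℤ) (con 1ℤ) x y z := z) refl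

  x1+y0+z0≈x : ∀ x y z → x · 1# + (y · 0# + z · 0#) ≈ x
  x1+y0+z0≈x = solve 3 (λ x y z → dot x y z (con 1ℤ) (con 0ℤ) (con 0ℤ) := x) refl

  x0+y1+z0≈y : ∀ x y z → x · 0# + (y · 1# + z · 0#) ≈ y
  x0+y1+z0≈y = solve 3 (λ x y z → dot x y z (con 0ℤ) (con 1ℤ) (con 0ℤ) := y) refl

  x0+y0+z1≈z : ∀ x y z → x · 0# + (y · 0# + z · 1#) ≈ z
  x0+y0+z1≈z = solve 3 (λ x y z → dot x y z (con 0ℤ) (con 0ℤ) (con 1ℤ) := z) refl

  I₃ : Mat3
  I₃ = mat 1# 0# 0#  0# 1# 0#  0# 0# 1#

  ⊗-identityˡ : ∀ A → I₃ ⊗ A ≈ₘ A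
  ⊗-identityˡ A 0F j = 1x+0y+0z≈x (A 0F j) (A 1F j) (A 2F j)
  ⊗-identityˡ A 1F j = 0x+1y+0z≈y (A 0F j) (A 1F j) (A 2F j)
  ⊗-identityˡ A 2F j = 0x+0y+1z≈z (A 0F j) (A 1F j) (A 2F j)

  ⊗-identityʳ : ∀ A → A ⊗ I₃ ≈ₘ A
  ⊗-identityʳ A i 0F = x1+y0+z0≈x (A i 0F) (A i 1F) (A i 2F)
  ⊗-identityʳ A i 1F = x0+y1+z0≈y (A i 0F) (A i 1F) (A i 2F)
  ⊗-identityʳ A i 2F = x0+y0+z1≈z (A i 0F) (A i 1F) (A i 2F)

  open SetoidReasoning Mat3-setoid

  rec3-step : ∀ {r s t} D {X₀ X₁ X₂} → X₁ ≈ₘ D ⊗ X₀ → X₂ ≈ₘ D ⊗ X₁ → lin3 r X₂ s X₁ t X₀ ≈ₘ D ⊗ X₂ →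
              ∀ n → rec3 r s t X₀ X₁ X₂ (suc n) ≈ₘ D ⊗ rec3 r s t X₀ X₁ X₂ n
  rec3-step D h₁ h₂ h₃ zero = h₁
  rec3-step D h₁ h₂ h₃ (suc zero) = h₂
  rec3-step D h₁ h₂ h₃ (suc (suc zero)) = h₃
  rec3-step {r} {s} {t} D {X₀} {X₁} {X₂} h₁ h₂ h₃ (suc (suc (suc n))) = begin
    lin3 r (X (suc (suc (suc n)))) s (X (suc (suc n))) t (X (suc n))
      ≈⟨ lin3-cong r s t (rec3-step D h₁ h₂ h₃ (suc (suc n))) (rec3-step D h₁ h₂ h₃ (suc n)) (rec3-step D h₁ h₂ h₃ n) ⟩
    lin3 r (D ⊗ X (suc (suc n))) s (D ⊗ X (suc n)) t (D ⊗ X n)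
      ≈⟨ ⊗-distribˡ-lin3 D r (X (suc (suc n))) s (X (suc n)) t (X n) ⟨
    D ⊗ X (suc (suc (suc n))) ∎
    where
    X : ℕ → Mat3
    X = rec3 r s t X₀ X₁ X₂

  rec3-geometric : ∀ {r s t} D D² → D² ≈ₘ D ⊗ D → lin3 r D² s D t I₃ ≈ₘ D ⊗ D² →
                   ∀ {X₀ X₁ X₂} → X₁ ≈ₘ D ⊗ X₀ → X₂ ≈ₘ D ⊗ X₁ →
                   ∀ n → rec3 r s t X₀ X₁ X₂ (suc n) ≈ₘ D ⊗ rec3 r s t X₀ X₁ X₂ n
  rec3-geometric {r} {s} {t} D D² D²≈DD cayley-hamilton {X₀} {X₁} {X₂} h₁ h₂ = rec3-step D h₁ h₂ h₃
    where
    X₂≈D²X₀ : X₂ ≈ₘ D² ⊗ X₀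
    X₂≈D²X₀ = begin
      X₂              ≈⟨ h₂ ⟩
      D ⊗ X₁          ≈⟨ ⊗-congˡ D h₁ ⟩
      D ⊗ (D ⊗ X₀)    ≈⟨ ⊗-assoc D D X₀ ⟨
      (D ⊗ D) ⊗ X₀    ≈⟨ ⊗-congʳ X₀ D²≈DD ⟨
      D² ⊗ X₀         ∎
    h₃ : lin3 r X₂ s X₁ t X₀ ≈ₘ D ⊗ X₂
    h₃ = begin
      lin3 r X₂ s X₁ t X₀                        ≈⟨ lin3-cong r s t X₂≈D²X₀ h₁ (≈ₘ-sym (⊗-identityˡ X₀)) ⟩
      lin3 r (D² ⊗ X₀) s (D ⊗ X₀) t (I₃ ⊗ X₀)    ≈⟨ ⊗-distribʳ-lin3 r D² s D t I₃ X₀ ⟨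
      lin3 r D² s D t I₃ ⊗ X₀                    ≈⟨ ⊗-congʳ X₀ cayley-hamilton ⟩
      (D ⊗ D²) ⊗ X₀                              ≈⟨ ⊗-assoc D D² X₀ ⟩
      D ⊗ (D² ⊗ X₀)                              ≈⟨ ⊗-congˡ D X₂≈D²X₀ ⟨
      D ⊗ X₂                                     ∎

module CompanionMatrix {ℓ₁ ℓ₂ : Level} (R : CommutativeRing ℓ₁ ℓ₂) (r s t : CommutativeRing.Carrier R) where
  open CommutativeRing R using (_≈_; _+_; 0#; 1#; refl; sym) renaming (_*_ to _·_)
  open IntegerCoefficients R using (solve; _:=_; _:+_; _:*_; con)
  open Matrices R
  open MatrixAlgebra R

  open SetoidReasoning Mat3-setoid

  Mhₙ : ℕ → Mat3
  Mhₙ = Mh r s t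

  T : Mat3
  T = Mhₙ 1

  T² : Mat3
  T² = Mhₙ 2

  companion-⊗ : ∀ A → T ⊗ A ≈ₘ
    mat (r · A 0F 0F + (s · A 1F 0F + t · A 2F 0F))
        (r · A 0F 1F + (s · A 1F 1F + t · A 2F 1F))
        (r · A 0F 2F + (s · A 1F 2F + t · A 2F 2F))
        (A 0F 0F) (A 0F 1F) (A 0F 2F)
        (A 1F 0F) (A 1F 1F) (A 1F 2F)
  companion-⊗ A = entrywise refl refl refl (e₀ 0F) (e₀ 1F) (e₀ 2F) (e₁ 0F) (e₁ 1F) (e₁ 2F)
    where
    e₀ : ∀ j → 1# · A 0F j + (0# · A 1F j + 0# · A 2F j) ≈ A 0F j
    e₀ j = 1x+0y+0z≈x (A 0F j) (A 1F j) (A 2F j)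
    e₁ : ∀ j → 0# · A 0F j + (1# · A 1F j + 0# · A 2F j) ≈ A 1F j
    e₁ j = 0x+1y+0z≈y (A 0F j) (A 1F j) (A 2F j)

  T²≈T⊗T : T² ≈ₘ T ⊗ T
  T²≈T⊗T = ≈ₘ-trans (entrywise e₀ e₁ e₂ refl refl refl refl refl refl) (≈ₘ-sym (companion-⊗ T))
    where
    e₀ : r · r + s ≈ r · r + (s · 1# + t · 0#)
    e₀ = solve 3 (λ r s t → r :* r :+ s := r :* r :+ (s :* con 1ℤ :+ t :* con 0ℤ)) refl r s t
    e₁ : r · s + t ≈ r · s + (s · 0# + t · 1#)
    e₁ = solve 3 (λ r s t → r :* s :+ t := r :* s :+ (s :* con 0ℤ :+ t :* con 1ℤ)) refl r s t
    e₂ : r · t ≈ r · t + (s · 0# + t · 0#)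
    e₂ = solve 3 (λ r s t → r :* t := r :* t :+ (s :* con 0ℤ :+ t :* con 0ℤ)) refl r s t

  -- Rows 1 and 2 of the left-hand side are, entry by entry, row 0 of T ⊗ T and of T ⊗ I₃.
  cayley-hamilton : lin3 r T² s T t I₃ ≈ₘ T ⊗ T²
  cayley-hamilton = ≈ₘ-trans
    (entrywise refl refl refl
      (sym (T²≈T⊗T 0F 0F)) (sym (T²≈T⊗T 0F 1F)) (sym (T²≈T⊗T 0F 2F))
      (⊗-identityʳ T 0F 0F) (⊗-identityʳ T 0F 1F) (⊗-identityʳ T 0F 2F))
    (≈ₘ-sym (companion-⊗ T²))

  Geometric : (ℕ → Mat3) → Set ℓ₂
  Geometric X = ∀ n → X (suc n) ≈ₘ T ⊗ X n

  Mh-geometric : Geometric Mhₙ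
  Mh-geometric = rec3-geometric T T² T²≈T⊗T cayley-hamilton (≈ₘ-sym (⊗-identityʳ T)) T²≈T⊗T

  geometric-shift : ∀ X → Geometric X → ∀ m k → X (m ℕ.+ k) ≈ₘ Mhₙ m ⊗ X k
  geometric-shift X geo zero k = ≈ₘ-sym (⊗-identityˡ (X k))
  geometric-shift X geo (suc m) k = begin
    X (suc (m ℕ.+ k))         ≈⟨ geo (m ℕ.+ k) ⟩
    T ⊗ X (m ℕ.+ k)           ≈⟨ ⊗-congˡ T (geometric-shift X geo m k) ⟩
    T ⊗ (Mhₙ m ⊗ X k)         ≈⟨ ⊗-assoc T (Mhₙ m) (X k) ⟨
    (T ⊗ Mhₙ m) ⊗ X k         ≈⟨ ⊗-congʳ (X k) (Mh-geometric m) ⟨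
    Mhₙ (suc m) ⊗ X k         ∎

  Mh-+ : ∀ m n → Mhₙ (m ℕ.+ n) ≈ₘ Mhₙ m ⊗ Mhₙ n
  Mh-+ = geometric-shift Mhₙ Mh-geometric

  Mh-comm : ∀ m n → Mhₙ m ⊗ Mhₙ n ≈ₘ Mhₙ n ⊗ Mhₙ m
  Mh-comm m n = begin
    Mhₙ m ⊗ Mhₙ n     ≈⟨ Mh-+ m n ⟨
    Mhₙ (m ℕ.+ n)     ≡⟨ ≡.cong Mhₙ (ℕ.+-comm m n) ⟩
    Mhₙ (n ℕ.+ m)     ≈⟨ Mh-+ n m ⟩
    Mhₙ n ⊗ Mhₙ m     ∎

  Central : Mat3 → Set ℓ₂
  Central A = ∀ n → A ⊗ Mhₙ n ≈ₘ Mhₙ n ⊗ A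

  lin3-central : ∀ x y z → Central (lin3 x I₃ y T z T²)
  lin3-central x y z n = begin
    lin3 x I₃ y T z T² ⊗ Mhₙ n
      ≈⟨ ⊗-distribʳ-lin3 x I₃ y T z T² (Mhₙ n) ⟩
    lin3 x (Mhₙ 0 ⊗ Mhₙ n) y (Mhₙ 1 ⊗ Mhₙ n) z (Mhₙ 2 ⊗ Mhₙ n)
      ≈⟨ lin3-cong x y z (Mh-comm 0 n) (Mh-comm 1 n) (Mh-comm 2 n) ⟩
    lin3 x (Mhₙ n ⊗ I₃) y (Mhₙ n ⊗ T) z (Mhₙ n ⊗ T²)
      ≈⟨ ⊗-distribˡ-lin3 (Mhₙ n) x I₃ y T z T² ⟨
    Mhₙ n ⊗ lin3 x I₃ y T z T² ∎

  ⊗-Mh-interchange : ∀ A B → Central B → ∀ m n → (A ⊗ Mhₙ m) ⊗ (B ⊗ Mhₙ n) ≈ₘ (A ⊗ B) ⊗ Mhₙ (m ℕ.+ n)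
  ⊗-Mh-interchange A B central m n = begin
    (A ⊗ Mhₙ m) ⊗ (B ⊗ Mhₙ n)   ≈⟨ ⊗-assoc A (Mhₙ m) (B ⊗ Mhₙ n) ⟩
    A ⊗ (Mhₙ m ⊗ (B ⊗ Mhₙ n))   ≈⟨ ⊗-congˡ A (⊗-assoc (Mhₙ m) B (Mhₙ n)) ⟨
    A ⊗ ((Mhₙ m ⊗ B) ⊗ Mhₙ n)   ≈⟨ ⊗-congˡ A (⊗-congʳ (Mhₙ n) (central m)) ⟨
    A ⊗ ((B ⊗ Mhₙ m) ⊗ Mhₙ n)   ≈⟨ ⊗-congˡ A (⊗-assoc B (Mhₙ m) (Mhₙ n)) ⟩
    A ⊗ (B ⊗ (Mhₙ m ⊗ Mhₙ n))   ≈⟨ ⊗-assoc A B (Mhₙ m ⊗ Mhₙ n) ⟨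
    (A ⊗ B) ⊗ (Mhₙ m ⊗ Mhₙ n)   ≈⟨ ⊗-congˡ (A ⊗ B) (Mh-+ m n) ⟨
    (A ⊗ B) ⊗ Mhₙ (m ℕ.+ n)     ∎

module HoradamMatrix {ℓ₁ ℓ₂ : Level} (R : CommutativeRing ℓ₁ ℓ₂) (r s t t⁻¹ a b c : CommutativeRing.Carrier R)
  (tt⁻¹≈1 : CommutativeRing._≈_ R (CommutativeRing._*_ R t t⁻¹) (CommutativeRing.1# R)) where
  open CommutativeRing R using (Carrier; _≈_; _+_; _-_; -_; 0#; 1#; refl; sym; trans; +-congˡ; +-assoc; *-assoc; *-congʳ; *-identityˡ)
    renaming (_*_ to _·_)
  open IntegerCoefficients R using (solve; _:=_; _:+_; _:*_; _:-_; :-_; con)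
  open Matrices R
  open MatrixAlgebra R
  open CompanionMatrix R r s t
  open SetoidReasoning Mat3-setoid

  H : ℕ → Mat3
  H = MH r s t t⁻¹ a b c

  t·t⁻¹x≈x : ∀ x → t · (t⁻¹ · x) ≈ x
  t·t⁻¹x≈x x = trans (sym (*-assoc t t⁻¹ x)) (trans (*-congʳ tt⁻¹≈1) (*-identityˡ x))

  H₁≈T⊗H₀ : H 1 ≈ₘ T ⊗ H 0
  H₁≈T⊗H₀ = ≈ₘ-trans (entrywise (trans e₀ t⁻¹-cancel) (trans e₁ t⁻¹-cancel) (trans e₂ t⁻¹-cancel)
    refl refl refl refl refl refl) (≈ₘ-sym (companion-⊗ (H 0)))
    where
    t⁻¹-cancel : ∀ {x y z} → x + (y + z) ≈ x + (y + t · (t⁻¹ · z))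
    t⁻¹-cancel = +-congˡ (+-congˡ (sym (t·t⁻¹x≈x _)))
    e₀ : c ≈ r · b + (s · a + (c - r · b - s · a))
    e₀ = solve 6 (λ r s t a b c → c := r :* b :+ (s :* a :+ (c :- r :* b :- s :* a))) refl r s t a b c
    e₁ : s · b + t · a ≈ r · (c - r · b) + (s · (b - r · a) + (t · a - r · (c - r · b - s · a)))
    e₁ = solve 6 (λ r s t a b c → s :* b :+ t :* a
           := r :* (c :- r :* b) :+ (s :* (b :- r :* a) :+ (t :* a :- r :* (c :- r :* b :- s :* a))))
         refl r s t a b c
    e₂ : t · b ≈ r · (t · a) + (s · (c - r · b - s · a) + (- (s · c) + (t + r · s) · b + (s · s - r · t) · a))
    e₂ = solve 6 (λ r s t a b c → t :* b
           := r :* (t :* a) :+ (s :* (c :- r :* b :- s :* a) :+ (:- (s :* c) :+ (t :+ r :* s) :* b :+ (s :* s :- r :* t) :* a)))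
         refl r s t a b c

  H₂≈T⊗H₁ : H 2 ≈ₘ T ⊗ H 1
  H₂≈T⊗H₁ = ≈ₘ-trans (entrywise (+-assoc (r · c) (s · b) (t · a)) e₁ e₂ refl refl refl refl refl refl)
    (≈ₘ-sym (companion-⊗ (H 1)))
    where
    e₁ : s · c + t · b ≈ r · (s · b + t · a) + (s · (c - r · b) + t · (b - r · a))
    e₁ = solve 6 (λ r s t a b c → s :* c :+ t :* b
           := r :* (s :* b :+ t :* a) :+ (s :* (c :- r :* b) :+ t :* (b :- r :* a)))
         refl r s t a b c
    e₂ : t · c ≈ r · (t · b) + (s · (t · a) + t · (c - r · b - s · a))
    e₂ = solve 6 (λ r s t a b c → t :* c := r :* (t :* b) :+ (s :* (t :* a) :+ t :* (c :- r :* b :- s :* a)))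
         refl r s t a b c

  H₁≈lin3-I₃-T-T² : H 1 ≈ₘ lin3 (c - r · b - s · a) I₃ (b - r · a) T a T²
  H₁≈lin3-I₃-T-T² = entrywise e₀₀ e₀₁ e₀₂ e₁₀ e₁₁ e₁₂
    (sym (x0+y0+z1≈z α β a)) (sym (x0+y1+z0≈y α β a)) (sym (x1+y0+z0≈x α β a))
    where
    α β : Carrier
    α = c - r · b - s · a
    β = b - r · a
    e₀₀ : c ≈ α · 1# + (β · r + a · (r · r + s))
    e₀₀ = solve 6 (λ r s t a b c → c
            := (c :- r :* b :- s :* a) :* con 1ℤ :+ ((b :- r :* a) :* r :+ a :* (r :* r :+ s)))
          refl r s t a b c
    e₀₁ : s · b + t · a ≈ α · 0# + (β · s + a · (r · s + t))
    e₀₁ = solve 6 (λ r s t a b c → s :* b :+ t :* a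
            := (c :- r :* b :- s :* a) :* con 0ℤ :+ ((b :- r :* a) :* s :+ a :* (r :* s :+ t)))
          refl r s t a b c
    e₀₂ : t · b ≈ α · 0# + (β · t + a · (r · t))
    e₀₂ = solve 6 (λ r s t a b c → t :* b
            := (c :- r :* b :- s :* a) :* con 0ℤ :+ ((b :- r :* a) :* t :+ a :* (r :* t)))
          refl r s t a b c
    e₁₀ : b ≈ α · 0# + (β · 1# + a · r)
    e₁₀ = solve 6 (λ r s t a b c → b
            := (c :- r :* b :- s :* a) :* con 0ℤ :+ ((b :- r :* a) :* con 1ℤ :+ a :* r))
          refl r s t a b c
    e₁₁ : c - r · b ≈ α · 1# + (β · 0# + a · s)
    e₁₁ = solve 6 (λ r s t a b c → c :- r :* b
            := (c :- r :* b :- s :* a) :* con 1ℤ :+ ((b :- r :* a) :* con 0ℤ :+ a :* s))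
          refl r s t a b c
    e₁₂ : t · a ≈ α · 0# + (β · 0# + a · t)
    e₁₂ = solve 6 (λ r s t a b c → t :* a
            := (c :- r :* b :- s :* a) :* con 0ℤ :+ ((b :- r :* a) :* con 0ℤ :+ a :* t))
          refl r s t a b c

  H-geometric : Geometric H
  H-geometric = rec3-geometric T T² T²≈T⊗T cayley-hamilton H₁≈T⊗H₀ H₂≈T⊗H₁

  H₁-central : Central (H 1)
  H₁-central n = begin
    H 1 ⊗ Mhₙ n     ≈⟨ ⊗-congʳ (Mhₙ n) H₁≈lin3-I₃-T-T² ⟩
    P ⊗ Mhₙ n       ≈⟨ lin3-central (c - r · b - s · a) (b - r · a) a n ⟩
    Mhₙ n ⊗ P       ≈⟨ ⊗-congˡ (Mhₙ n) H₁≈lin3-I₃-T-T² ⟨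
    Mhₙ n ⊗ H 1     ∎
    where
    P : Mat3
    P = lin3 (c - r · b - s · a) I₃ (b - r · a) T a T²

  H-+1 : ∀ n → H (n ℕ.+ 1) ≈ₘ H 1 ⊗ Mhₙ n
  H-+1 n = ≈ₘ-trans (geometric-shift H H-geometric n 1) (≈ₘ-sym (H₁-central n))

  ⊗-H-+1 : ∀ A m n → (A ⊗ Mhₙ m) ⊗ H (n ℕ.+ 1) ≈ₘ (A ⊗ H 1) ⊗ Mhₙ (m ℕ.+ n)
  ⊗-H-+1 A m n = ≈ₘ-trans (⊗-congˡ (A ⊗ Mhₙ m) (H-+1 n)) (⊗-Mh-interchange A (H 1) H₁-central m n)

  ⊗-H₁-⊗-Mh : ∀ A m → (A ⊗ H 1) ⊗ Mhₙ m ≈ₘ A ⊗ H (m ℕ.+ 1)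
  ⊗-H₁-⊗-Mh A m = ≈ₘ-trans (⊗-assoc A (H 1) (Mhₙ m)) (≈ₘ-sym (⊗-congˡ A (H-+1 m)))

  H-+1-square : ∀ n → H (n ℕ.+ 1) ⊗ H (n ℕ.+ 1) ≈ₘ (H 1 ⊗ H 1) ⊗ Mhₙ (2 ℕ.* n)
  H-+1-square n = begin
    H (n ℕ.+ 1) ⊗ H (n ℕ.+ 1)        ≈⟨ ⊗-congʳ (H (n ℕ.+ 1)) (H-+1 n) ⟩
    (H 1 ⊗ Mhₙ n) ⊗ H (n ℕ.+ 1)      ≈⟨ ⊗-H-+1 (H 1) n n ⟩
    (H 1 ⊗ H 1) ⊗ Mhₙ (n ℕ.+ n)      ≡⟨ ≡.cong (λ k → (H 1 ⊗ H 1) ⊗ Mhₙ (n ℕ.+ k)) (ℕ.+-identityʳ n) ⟨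
    (H 1 ⊗ H 1) ⊗ Mhₙ (2 ℕ.* n)      ∎

  H-+1-cube : ∀ n → (H (n ℕ.+ 1) ⊗ H (n ℕ.+ 1)) ⊗ H (n ℕ.+ 1) ≈ₘ ((H 1 ⊗ H 1) ⊗ H 1) ⊗ Mhₙ (3 ℕ.* n)
  H-+1-cube n = begin
    (H (n ℕ.+ 1) ⊗ H (n ℕ.+ 1)) ⊗ H (n ℕ.+ 1)   ≈⟨ ⊗-congʳ (H (n ℕ.+ 1)) (H-+1-square n) ⟩
    ((H 1 ⊗ H 1) ⊗ Mhₙ (2 ℕ.* n)) ⊗ H (n ℕ.+ 1) ≈⟨ ⊗-H-+1 (H 1 ⊗ H 1) (2 ℕ.* n) n ⟩
    ((H 1 ⊗ H 1) ⊗ H 1) ⊗ Mhₙ (2 ℕ.* n ℕ.+ n)   ≡⟨ ≡.cong (λ k → ((H 1 ⊗ H 1) ⊗ H 1) ⊗ Mhₙ k) (ℕ.+-comm (2 ℕ.* n) n) ⟩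
    ((H 1 ⊗ H 1) ⊗ H 1) ⊗ Mhₙ (3 ℕ.* n)         ∎

open import Data.Nat using (_+_; _*_)

corollary3p4 : {c ℓ : Level} (R : CommutativeRing c ℓ) →
    let open Matrices R in
    (r s t tinv a b c : CommutativeRing.Carrier R) →
      CommutativeRing._≈_ R (CommutativeRing._*_ R t tinv) (CommutativeRing.1# R) → (n : ℕ) →
      ((MH r s t tinv a b c (n + 1) ⊗ MH r s t tinv a b c (n + 1))
          ≈ₘ ((MH1 r s t a b c ⊗ MH1 r s t a b c) ⊗ Mh r s t (2 * n))
       × ((MH1 r s t a b c ⊗ MH1 r s t a b c) ⊗ Mh r s t (2 * n))
          ≈ₘ (MH1 r s t a b c ⊗ MH r s t tinv a b c (2 * n + 1)))
      × ((MH r s t tinv a b c (n + 1) ⊗ MH r s t tinv a b c (n + 1)) ⊗ MH r s t tinv a b c (n + 1)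
          ≈ₘ (((MH1 r s t a b c ⊗ MH1 r s t a b c) ⊗ MH1 r s t a b c) ⊗ Mh r s t (3 * n))
       × (((MH1 r s t a b c ⊗ MH1 r s t a b c) ⊗ MH1 r s t a b c) ⊗ Mh r s t (3 * n))
          ≈ₘ ((MH1 r s t a b c ⊗ MH1 r s t a b c) ⊗ MH r s t tinv a b c (3 * n + 1)))
corollary3p4 R r s t tinv a b c tt⁻¹≈1 n =
  (H-+1-square n , ⊗-H₁-⊗-Mh (H 1) (2 * n)) , (H-+1-cube n , ⊗-H₁-⊗-Mh (H 1 ⊗ H 1) (3 * n))
  where
  open Matrices R using (_⊗_)
  open HoradamMatrix R r s t tinv a b c tt⁻¹≈1
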